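{- Let $P$ be an $NE$-free poset whose decomposition tree has no least element, i.e. there is no robust module of $P$ containing every robust module of $P$. Then $P$ is connected and $P$ has property CCGC.
   Context: A poset is $NE$-free if it has no induced subposet isomorphic to $N$: the poset on $\{a,b,c,d\}$ with $a<b$, $c<b$, $c<d$ and $a,c$; $b,d$; $a,d$ pairwise incomparable. A module of $P$ is a subset $M\subseteq P$ such that for every $z\in P\setminus M$ and all $y,y'\in M$: $z<y\iff z<y'$ and $y<z\iff y'<z$. A strong module is a non-empty module that is comparable under inclusion with every module it meets. A robust module is either a singleton or, for some distinct $x,y\in P$, the intersection of all strong modules containing $\{x,y\}$. The decomposition tree of $P$ is the set of robust modules ordered by reverse inclusion. $P$ is connected if its comparability graph $CG(P)$ (edges between distinct comparable elements) is connected; $P$ has property CCGC if the complement of $CG(P)$ is connected. -}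

module Defs where

open import Level using (Level; Setω; 0ℓ) renaming (suc to lsuc)
open import Data.Product using (Σ; ∃; _×_; _,_)
open import Data.Sum using (_⊎_)
open import Relation.Nullary using (¬_)
open import Relation.Binary.PropositionalEquality using (_≡_; _≢_)
open import Relation.Binary.Construct.Closure.ReflexiveTransitive using (Star)

-- A poset P is given by a carrier A and its strict order _<_
-- (an IsStrictPartialOrder w.r.t. propositional equality; see Statement).
-- Subsets of A at universe level ℓ are predicates A → Set ℓ.

module _ {A : Set} (_<_ : A → A → Set) where

  Incomp : A → A → Set
  Incomp x y = ¬ (x < y) × ¬ (y < x)

  -- P is NE-free: no a,b,c,d inducing the poset N
  -- (a<b, c<b, c<d, a∥c, b∥d, a∥d; distinctness of a,b,c,d follows
  -- from these relations and irreflexivity/transitivity).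
  NEFree : Set
  NEFree = ¬ (Σ A λ a → Σ A λ b → Σ A λ c → Σ A λ d →
              (a < b) × (c < b) × (c < d) ×
              Incomp a c × Incomp b d × Incomp a d)

  IsModule : {ℓ : Level} → (A → Set ℓ) → Set ℓ
  IsModule M = ∀ z y y' → ¬ M z → M y → M y' →
                 ((z < y → z < y') × (z < y' → z < y)) ×
                 ((y < z → y' < z) × (y' < z → y < z))

  _⊆_ : {ℓ ℓ' : Level} → (A → Set ℓ) → (A → Set ℓ') → Set _
  M ⊆ N = ∀ z → M z → N z

  IsStrong : (A → Set) → Set₁
  IsStrong M = (∃ λ z → M z) × IsModule M ×
               (∀ (N : A → Set) → IsModule N → (∃ λ z → M z × N z) →
                  (M ⊆ N) ⊎ (N ⊆ M))

  Gen : A → A → A → Set₁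
  Gen x y z = ∀ (M : A → Set) → IsStrong M → M x → M y → M z

  _≐_ : {ℓ ℓ' : Level} → (A → Set ℓ) → (A → Set ℓ') → Set _
  M ≐ N = (M ⊆ N) × (N ⊆ M)

  IsRobust : (A → Set₁) → Set₁
  IsRobust R = (∃ λ a → R ≐ (λ z → z ≡ a)) ⊎
               (Σ A λ x → Σ A λ y → (x ≢ y) × (R ≐ Gen x y))

  -- the decomposition tree (robust modules ordered by reverse inclusion)
  -- has a least element: a robust module containing every robust module
  HasLeast : Set₂
  HasLeast = Σ (A → Set₁) λ R → IsRobust R ×
               (∀ (R' : A → Set₁) → IsRobust R' → R' ⊆ R)

  CGEdge : A → A → Set
  CGEdge x y = (x ≢ y) × ((x < y) ⊎ (y < x))

  CoCGEdge : A → A → Set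
  CoCGEdge x y = (x ≢ y) × Incomp x y

  Connected : Set
  Connected = ∀ x y → Star CGEdge x y

  CCGC : Set
  CCGC = ∀ x y → Star CoCGEdge x y

LEM : Setω
LEM = ∀ {ℓ : Level} (X : Set ℓ) → X ⊎ ¬ X

{-# OPTIONS --safe #-}
-- If x and y lie in different components of CG(P), the component of y and
-- its complement are complementary modules; a strong module containing x and
-- y meets both and so contains both, i.e. the robust module generated by x
-- and y is all of P and is the least element of the decomposition tree.
-- The same works for co-components: if x < y lie in different co-components,
-- every element outside the co-component of y is comparable to it, always on
-- the same side, so the co-component of y together with the strict up-set of
-- y is a module whose complement lies entirely below it.
module Submission where

open import Defs
open import Level using (0ℓ)
open import Data.Product using (_×_; _,_; proj₁; proj₂; swap)
open import Data.Sum using (_⊎_; inj₁; inj₂; [_,_])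
open import Data.Empty using (⊥-elim)
open import Function using (_∘_)
open import Relation.Nullary using (¬_)
open import Relation.Unary using (Pred; ∁)
open import Relation.Binary.Definitions using (Asymmetric)
open import Relation.Binary.PropositionalEquality using (_≡_; _≢_; refl; sym)
open import Relation.Binary.Structures using (IsStrictPartialOrder)
open import Relation.Binary.Construct.Closure.ReflexiveTransitive using (Star; ε; _◅_; _◅◅_; reverse)

module _ (lem : LEM) {A : Set} (_<_ : A → A → Set) where

  stable : {X : Set} → ¬ ¬ X → X
  stable {X} ¬¬x with lem X
  ... | inj₁ x  = x
  ... | inj₂ ¬x = ⊥-elim (¬¬x ¬x)

  module⊆strong : ∀ {M N : Pred A 0ℓ} {a b} → IsStrong _<_ M → IsModule _<_ N →
                  M a → N a → M b → ¬ N b → ∀ z → N z → M z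
  module⊆strong (_ , _ , comparable) isN Ma Na Mb ¬Nb with comparable _ isN (_ , Ma , Na)
  ... | inj₁ M⊆N = ⊥-elim (¬Nb (M⊆N _ Mb))
  ... | inj₂ N⊆M = N⊆M

  split⇒Gen-universal : ∀ {S : Pred A 0ℓ} {a b} → IsModule _<_ S × IsModule _<_ (∁ S) →
                        S a → ¬ S b → ∀ z → Gen _<_ a b z
  split⇒Gen-universal {S} (isS , is∁S) Sa ¬Sb z M strong Ma Mb with lem (S z)
  ... | inj₁ Sz  = module⊆strong strong isS  Ma Sa  Mb ¬Sb      z Sz
  ... | inj₂ ¬Sz = module⊆strong strong is∁S Mb ¬Sb Ma (λ ¬Sa → ¬Sa Sa) z ¬Sz

  Gen-universal⇒HasLeast : ∀ {a b} → a ≢ b → (∀ z → Gen _<_ a b z) → HasLeast _<_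
  Gen-universal⇒HasLeast {a} {b} a≢b universal =
    Gen _<_ a b , inj₂ (a , b , a≢b , (λ _ g → g) , (λ _ g → g)) , λ _ _ z _ → universal z

  split⇒HasLeast : ∀ {S : Pred A 0ℓ} {a b} → IsModule _<_ S × IsModule _<_ (∁ S) →
                   S a → ¬ S b → HasLeast _<_
  split⇒HasLeast split Sa ¬Sb =
    Gen-universal⇒HasLeast (λ { refl → ¬Sb Sa }) (split⇒Gen-universal split Sa ¬Sb)

  incomparable⇒isModule : ∀ {S : Pred A 0ℓ} → (∀ {u v} → ¬ S u → S v → Incomp _<_ u v) →
                          IsModule _<_ S
  incomparable⇒isModule sep z y y' ¬Sz Sy Sy' =
    (⊥-elim ∘ proj₁ (sep ¬Sz Sy) , ⊥-elim ∘ proj₁ (sep ¬Sz Sy')) ,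
    (⊥-elim ∘ proj₂ (sep ¬Sz Sy) , ⊥-elim ∘ proj₂ (sep ¬Sz Sy'))

  incomparable⇒split : ∀ {S : Pred A 0ℓ} → (∀ {u v} → ¬ S u → S v → Incomp _<_ u v) →
                       IsModule _<_ S × IsModule _<_ (∁ S)
  incomparable⇒split sep =
    incomparable⇒isModule sep , incomparable⇒isModule (λ ¬¬Su ¬Sv → swap (sep ¬Sv (stable ¬¬Su)))

  module _ (asym : Asymmetric _<_) where

    below⇒isModule : ∀ {S : Pred A 0ℓ} → (∀ {u v} → ¬ S u → S v → u < v) → IsModule _<_ S
    below⇒isModule sep z y y' ¬Sz Sy Sy' =
      ((λ _ → sep ¬Sz Sy') , (λ _ → sep ¬Sz Sy)) ,
      (⊥-elim ∘ asym (sep ¬Sz Sy) , ⊥-elim ∘ asym (sep ¬Sz Sy'))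

    above⇒isModule : ∀ {S : Pred A 0ℓ} → (∀ {u v} → ¬ S u → S v → v < u) → IsModule _<_ S
    above⇒isModule sep z y y' ¬Sz Sy Sy' =
      (⊥-elim ∘ asym (sep ¬Sz Sy) , ⊥-elim ∘ asym (sep ¬Sz Sy')) ,
      ((λ _ → sep ¬Sz Sy') , (λ _ → sep ¬Sz Sy))

    below⇒split : ∀ {S : Pred A 0ℓ} → (∀ {u v} → ¬ S u → S v → u < v) →
                  IsModule _<_ S × IsModule _<_ (∁ S)
    below⇒split sep = below⇒isModule sep , above⇒isModule (λ ¬¬Su ¬Sv → sep ¬Sv (stable ¬¬Su))

  CG CO : A → A → Set
  CG = CGEdge _<_
  CO = CoCGEdge _<_

  component-isolated : ∀ {x u v} → ¬ Star CG x u → Star CG x v → Incomp _<_ u v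
  component-isolated {x} {u} {v} ¬xu xv = (λ u<v → ¬xu (xv ◅◅ edge (inj₂ u<v))) ,
                                          (λ v<u → ¬xu (xv ◅◅ edge (inj₁ v<u)))
    where
      edge : (v < u) ⊎ (u < v) → Star CG v u
      edge comparable = ((λ { refl → ¬xu xv }) , comparable) ◅ ε

  connected : ¬ HasLeast _<_ → Connected _<_
  connected ¬least x y with lem (Star CG x y)
  ... | inj₁ path  = path
  ... | inj₂ ¬path = ⊥-elim (¬least (split⇒HasLeast (incomparable⇒split component-isolated) ε ¬path))

  CO-sym : ∀ {u v} → CO u v → CO v u
  CO-sym (u≢v , incomp) = (u≢v ∘ sym) , swap incomp

  outside-co-component-comparable : ∀ {y w} → ¬ Star CO y w → (w < y) ⊎ (y < w)
  outside-co-component-comparable {y} {w} ¬yw with lem (w < y) | lem (y < w)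
  ... | inj₁ w<y | _        = inj₁ w<y
  ... | inj₂ _   | inj₁ y<w = inj₂ y<w
  ... | inj₂ w≮y | inj₂ y≮w = ⊥-elim (¬yw (((λ { refl → ¬yw ε }) , y≮w , w≮y) ◅ ε))

  module _ (spo : IsStrictPartialOrder _≡_ _<_) where
    open IsStrictPartialOrder spo using (trans; asym)

    below-co-component : ∀ {y w v} → ¬ Star CO y w → w < y → Star CO y v → w < v
    below-co-component ¬yw w<y ε = w<y
    below-co-component ¬yw w<y (e ◅ path) with outside-co-component-comparable (¬yw ∘ (e ◅_))
    ... | inj₁ w<b = below-co-component (¬yw ∘ (e ◅_)) w<b path
    ... | inj₂ b<w = ⊥-elim (proj₂ (proj₂ e) (trans b<w w<y))

    CoUp : A → Pred A 0ℓ
    CoUp y w = Star CO y w ⊎ (y < w)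

    outside-CoUp-below : ∀ {y u v} → ¬ CoUp y u → CoUp y v → u < v
    outside-CoUp-below ¬Uu Uv with outside-co-component-comparable (¬Uu ∘ inj₁)
    ... | inj₂ y<u = ⊥-elim (¬Uu (inj₂ y<u))
    ... | inj₁ u<y with Uv
    ...   | inj₁ path = below-co-component (¬Uu ∘ inj₁) u<y path
    ...   | inj₂ y<v  = trans u<y y<v

    ccgc : ¬ HasLeast _<_ → CCGC _<_
    ccgc ¬least x y with lem (Star CO x y)
    ... | inj₁ path = path
    ... | inj₂ ¬xy with outside-co-component-comparable ¬xy
    ...   | inj₁ y<x = ⊥-elim (¬least (split⇒HasLeast (below⇒split asym outside-CoUp-below)
                                         (inj₁ ε) [ ¬xy , asym y<x ]))
    ...   | inj₂ x<y = ⊥-elim (¬least (split⇒HasLeast (below⇒split asym outside-CoUp-below)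
                                         (inj₁ ε) [ ¬xy ∘ reverse CO-sym , asym x<y ]))

mainTheorem8 : LEM → (A : Set) (_<_ : A → A → Set) →
    IsStrictPartialOrder _≡_ _<_ → NEFree _<_ → ¬ HasLeast _<_ →
    Connected _<_ × CCGC _<_
mainTheorem8 lem A _<_ spo _ ¬least = connected lem _<_ ¬least , ccgc lem _<_ spo ¬least
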